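{- For every integer $n\ge 1$, the pentagonal book $B_{5,n}$ is neighborhood-prime.
   Context: A neighborhood-prime labeling of a simple graph $G$ with $N$ vertices is a bijection $f:V(G)\to\{1,\ldots,N\}$ such that for every vertex $v$ with $\deg(v)>1$, $\gcd\{f(u):u\in N(v)\}=1$, where $N(v)$ is the neighborhood of $v$; a graph admitting one is neighborhood-prime. The pentagonal book $B_{5,n}$ consists of $n$ copies of the 5-cycle all sharing a single common edge $u_1u_2$: its vertices are $u_1,u_2$ and $v_i,w_i,x_i$ for $i=1,\ldots,n$, with edges $u_1u_2$ and, for each $i$, the path $u_1,v_i,w_i,x_i,u_2$. -}

module Defs where

open import Data.Nat using (ℕ; suc; _+_; _*_)
open import Data.Nat.Divisibility using (_∣_)
open import Data.Fin using (Fin; toℕ)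
open import Data.Product using (Σ; ∃; _×_; _,_)
open import Data.Empty using (⊥)
open import Relation.Nullary using (¬_)
open import Relation.Binary.PropositionalEquality using (_≡_)
open import Function.Bundles using (_⤖_; Bijection)

record Graph : Set₁ where
  field
    V     : Set
    Adj   : V → V → Set
    sym   : ∀ {a b} → Adj a b → Adj b a
    irr   : ∀ {a} → ¬ Adj a a

open Graph public

DegGt1 : (G : Graph) → V G → Set
DegGt1 G v = Σ (V G) λ a → Σ (V G) λ b → Adj G v a × Adj G v b × ¬ (a ≡ b)

label : ∀ {A : Set} {N : ℕ} → (A ⤖ Fin N) → A → ℕ
label f a = suc (toℕ (Bijection.to f a))

NbhdGcd1 : (G : Graph) {N : ℕ} → (V G ⤖ Fin N) → V G → Set
NbhdGcd1 G f v = ∀ (d : ℕ) → (∀ u → Adj G v u → d ∣ label f u) → d ∣ 1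

NeighborhoodPrimeLabeling : (G : Graph) (N : ℕ) → (V G ⤖ Fin N) → Set
NeighborhoodPrimeLabeling G N f = ∀ v → DegGt1 G v → NbhdGcd1 G f v

NeighborhoodPrime : (G : Graph) (N : ℕ) → Set
NeighborhoodPrime G N = Σ (V G ⤖ Fin N) λ f → NeighborhoodPrimeLabeling G N f

data BV (n : ℕ) : Set where
  u₁ u₂ : BV n
  v w x : Fin n → BV n

data BE {n : ℕ} : BV n → BV n → Set where
  e-u₁u₂ : BE u₁ u₂
  e-u₁v  : ∀ i → BE u₁ (v i)
  e-vw   : ∀ i → BE (v i) (w i)
  e-wx   : ∀ i → BE (w i) (x i)
  e-xu₂  : ∀ i → BE (x i) u₂

data BAdj {n : ℕ} (a b : BV n) : Set where
  fwd : BE a b → BAdj a b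
  bwd : BE b a → BAdj a b

BAdj-sym : ∀ {n} {a b : BV n} → BAdj a b → BAdj b a
BAdj-sym (fwd e) = bwd e
BAdj-sym (bwd e) = fwd e

BE-irr : ∀ {n} {a : BV n} → ¬ BE a a
BE-irr ()

BAdj-irr : ∀ {n} {a : BV n} → ¬ BAdj a a
BAdj-irr (fwd e) = BE-irr e
BAdj-irr (bwd e) = BE-irr e

PentagonalBook : ℕ → Graph
PentagonalBook n = record { V = BV n ; Adj = BAdj ; sym = BAdj-sym ; irr = BAdj-irr }

pbSize : ℕ → ℕ
pbSize n = 2 + 3 * n

-- Label u₁, w₁, u₂, v₁, x₁ by 1, 2, 3, 4, 5 and the pages i = 2, …, n by
-- v_i, x_i, w_i ↦ 3i, 3i + 1, 3i + 2. Every vertex then has two neighbours with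
-- coprime labels: u₂ and v_i see u₁ (label 1); u₁, w_i and x₁ see two
-- consecutive labels (3 and 4; those of v_i and x_i; 2 and 3); and x_i for
-- i ≥ 2 sees u₂ (label 3) and w_i, whose label is 2 modulo 3.
module Submission where

open import Defs hiding (sym)
open import Data.Nat using (ℕ; _≥_; zero; suc; _+_; _*_)
open import Data.Nat.Properties using (+-comm; *-comm; *-suc; *-distribˡ-+)
open import Data.Nat.Divisibility using (_∣_; ∣-reflexive; ∣-trans; m∣m*n; ∣m+n∣m⇒∣n; ∣1⇒≡1)
open import Data.Nat.Coprimality using (Coprime; 1-coprimeTo)
open import Data.Fin using (Fin; toℕ; zero; suc; cast; _↑ˡ_; _↑ʳ_; combine)
open import Data.Fin.Patterns using (0F; 1F; 2F; 3F; 4F)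
open import Data.Fin.Properties using (toℕ-cast; cast-involutive; toℕ-↑ˡ; toℕ-↑ʳ; toℕ-combine; +↔⊎; *↔×)
open import Data.Sum using (_⊎_; inj₁; inj₂)
open import Data.Sum.Function.Propositional using (_⊎-↔_)
open import Data.Product using (_×_; _,_)
open import Function.Bundles using (_⤖_; _↔_; Inverse; mk↔ₛ′)
open import Function.Properties.Inverse using (↔-refl; ↔-sym; ↔-trans; ↔⇒⤖)
open import Relation.Binary.PropositionalEquality using (_≡_; refl; sym; cong; subst; subst₂; module ≡-Reasoning)

coprime-suc : ∀ n → Coprime n (suc n)
coprime-suc n {d} (d∣n , d∣1+n) = ∣1⇒≡1 (∣m+n∣m⇒∣n (subst (d ∣_) (+-comm 1 n) d∣1+n) d∣n)

coprime-*+ : ∀ {m n} q → Coprime m n → Coprime (n * q + m) n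
coprime-*+ q c (d∣nq+m , d∣n) = c (∣m+n∣m⇒∣n d∣nq+m (∣-trans d∣n (m∣m*n q)) , d∣n)

coprime-8+3*-3 : ∀ k → Coprime (8 + 3 * k) 3
coprime-8+3*-3 k = subst (λ l → Coprime l 3) 3*[2+k]+2≡8+3*k (coprime-*+ (2 + k) (coprime-suc 2))
  where
  open ≡-Reasoning
  3*[2+k]+2≡8+3*k : 3 * (2 + k) + 2 ≡ 8 + 3 * k
  3*[2+k]+2≡8+3*k = begin
    3 * (2 + k) + 2    ≡⟨ +-comm (3 * (2 + k)) 2 ⟩
    2 + 3 * (2 + k)    ≡⟨ cong (2 +_) (*-distribˡ-+ 3 2 k) ⟩
    8 + 3 * k          ∎

module _ (G : Graph) {N : ℕ} (f : V G ⤖ Fin N) where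

  coprime-neighbours⇒NbhdGcd1 : ∀ {v a b} → Adj G v a → Adj G v b →
                                 Coprime (label f a) (label f b) → NbhdGcd1 G f v
  coprime-neighbours⇒NbhdGcd1 va vb coprime d d∣labels = ∣-reflexive (coprime (d∣labels _ va , d∣labels _ vb))

cast↔ : ∀ {m n} → m ≡ n → Fin m ↔ Fin n
cast↔ eq = mk↔ₛ′ (cast eq) (cast (sym eq)) (cast-involutive eq (sym eq)) (cast-involutive (sym eq) eq)

-- The vertices of B_{5,1+m}: five distinguished ones, then three per page i = 2, …, 1+m.
Slot : ℕ → Set
Slot m = Fin 5 ⊎ (Fin m × Fin 3)

encode : ∀ {m} → BV (suc m) → Slot m
encode u₁          = inj₁ 0F
encode (w zero)    = inj₁ 1F
encode u₂          = inj₁ 2F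
encode (v zero)    = inj₁ 3F
encode (x zero)    = inj₁ 4F
encode (v (suc k)) = inj₂ (k , 0F)
encode (x (suc k)) = inj₂ (k , 1F)
encode (w (suc k)) = inj₂ (k , 2F)

decode : ∀ {m} → Slot m → BV (suc m)
decode (inj₁ 0F)       = u₁
decode (inj₁ 1F)       = w zero
decode (inj₁ 2F)       = u₂
decode (inj₁ 3F)       = v zero
decode (inj₁ 4F)       = x zero
decode (inj₂ (k , 0F)) = v (suc k)
decode (inj₂ (k , 1F)) = x (suc k)
decode (inj₂ (k , 2F)) = w (suc k)

encode-decode : ∀ {m} (s : Slot m) → encode (decode s) ≡ s
encode-decode (inj₁ 0F)       = refl
encode-decode (inj₁ 1F)       = refl
encode-decode (inj₁ 2F)       = refl
encode-decode (inj₁ 3F)       = refl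
encode-decode (inj₁ 4F)       = refl
encode-decode (inj₂ (k , 0F)) = refl
encode-decode (inj₂ (k , 1F)) = refl
encode-decode (inj₂ (k , 2F)) = refl

decode-encode : ∀ {m} (a : BV (suc m)) → decode (encode a) ≡ a
decode-encode u₁          = refl
decode-encode u₂          = refl
decode-encode (v zero)    = refl
decode-encode (v (suc k)) = refl
decode-encode (w zero)    = refl
decode-encode (w (suc k)) = refl
decode-encode (x zero)    = refl
decode-encode (x (suc k)) = refl

vertex↔slot : ∀ {m} → BV (suc m) ↔ Slot m
vertex↔slot = mk↔ₛ′ encode decode encode-decode decode-encode

slot↔fin : ∀ {m} → Slot m ↔ Fin (5 + m * 3)
slot↔fin = ↔-trans (↔-refl ⊎-↔ ↔-sym *↔×) (↔-sym +↔⊎)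

slotLabel : ∀ {m} → Slot m → ℕ
slotLabel (inj₁ i)       = suc (toℕ i)
slotLabel (inj₂ (k , r)) = 6 + (toℕ r + 3 * toℕ k)

label-slot↔fin : ∀ {m} (s : Slot m) → suc (toℕ (Inverse.to slot↔fin s)) ≡ slotLabel s
label-slot↔fin {m} (inj₁ i)       = cong suc (toℕ-↑ˡ i (m * 3))
label-slot↔fin     (inj₂ (k , r)) = begin
  suc (toℕ (5 ↑ʳ combine k r))   ≡⟨ cong suc (toℕ-↑ʳ 5 (combine k r)) ⟩
  6 + toℕ (combine k r)          ≡⟨ cong (6 +_) (toℕ-combine k r) ⟩
  6 + (3 * toℕ k + toℕ r)        ≡⟨ cong (6 +_) (+-comm (3 * toℕ k) (toℕ r)) ⟩
  6 + (toℕ r + 3 * toℕ k)        ∎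
  where open ≡-Reasoning

pbSize-suc : ∀ m → 5 + m * 3 ≡ pbSize (suc m)
pbSize-suc m = cong (2 +_) (begin
  3 + m * 3    ≡⟨ cong (3 +_) (*-comm m 3) ⟩
  3 + 3 * m    ≡⟨ sym (*-suc 3 m) ⟩
  3 * suc m    ∎)
  where open ≡-Reasoning

bookLabelling : ∀ m → BV (suc m) ⤖ Fin (pbSize (suc m))
bookLabelling m = ↔⇒⤖ (↔-trans vertex↔slot (↔-trans slot↔fin (cast↔ (pbSize-suc m))))

label-bookLabelling : ∀ m a → label (bookLabelling m) a ≡ slotLabel (encode a)
label-bookLabelling m a = begin
  suc (toℕ (cast _ (Inverse.to slot↔fin (encode a))))  ≡⟨ cong suc (toℕ-cast (pbSize-suc m) _) ⟩
  suc (toℕ (Inverse.to slot↔fin (encode a)))           ≡⟨ label-slot↔fin (encode a) ⟩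
  slotLabel (encode a)                                 ∎
  where open ≡-Reasoning

module _ (m : ℕ) where

  private
    G = PentagonalBook (suc m)

  coprime-slots⇒NbhdGcd1 : ∀ {c a b} → Adj G c a → Adj G c b →
                            Coprime (slotLabel (encode a)) (slotLabel (encode b)) →
                            NbhdGcd1 G (bookLabelling m) c
  coprime-slots⇒NbhdGcd1 {a = a} {b} ca cb coprime = coprime-neighbours⇒NbhdGcd1 G (bookLabelling m) ca cb
    (subst₂ Coprime (sym (label-bookLabelling m a)) (sym (label-bookLabelling m b)) coprime)

  bookLabelling-neighborhoodPrime : NeighborhoodPrimeLabeling G (pbSize (suc m)) (bookLabelling m)
  bookLabelling-neighborhoodPrime u₁          _ =
    coprime-slots⇒NbhdGcd1 (fwd e-u₁u₂) (fwd (e-u₁v zero)) (coprime-suc 3)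
  bookLabelling-neighborhoodPrime u₂          _ =
    coprime-slots⇒NbhdGcd1 (bwd e-u₁u₂) (bwd e-u₁u₂) (1-coprimeTo 1)
  bookLabelling-neighborhoodPrime (v i)       _ =
    coprime-slots⇒NbhdGcd1 (bwd (e-u₁v i)) (bwd (e-u₁v i)) (1-coprimeTo 1)
  bookLabelling-neighborhoodPrime (w zero)    _ =
    coprime-slots⇒NbhdGcd1 (bwd (e-vw zero)) (fwd (e-wx zero)) (coprime-suc 4)
  bookLabelling-neighborhoodPrime (w (suc k)) _ =
    coprime-slots⇒NbhdGcd1 (bwd (e-vw (suc k))) (fwd (e-wx (suc k))) (coprime-suc (6 + 3 * toℕ k))
  bookLabelling-neighborhoodPrime (x zero)    _ =
    coprime-slots⇒NbhdGcd1 (bwd (e-wx zero)) (fwd (e-xu₂ zero)) (coprime-suc 2)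
  bookLabelling-neighborhoodPrime (x (suc k)) _ =
    coprime-slots⇒NbhdGcd1 (bwd (e-wx (suc k))) (fwd (e-xu₂ (suc k))) (coprime-8+3*-3 (toℕ k))

mainTheorem8 : ∀ (n : ℕ) → n ≥ 1 → NeighborhoodPrime (PentagonalBook n) (pbSize n)
mainTheorem8 (suc m) _ = bookLabelling m , bookLabelling-neighborhoodPrime m
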